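{- Let $G$ be a connected graph. Then $G$ is distance exceptional if and only if $\iota(G)=0$.
   Context: All graphs are finite, simple, undirected. For a connected graph $G$ with vertices $v_1,\dots,v_n$, $D=(d(v_i,v_j))_{i,j}$ is its shortest-path distance matrix and $\vec 1$ the all-ones vector. A curvature potential is a vector $\vec x$ with $D\vec x=\vec 1$; $G$ is distance exceptional if it has no curvature potential. Let $X(G)=\{D\vec x:\vec x\in\mathbb{R}^n,\ \vec x^\top\vec 1=1\}$. If $G$ is distance exceptional or has a curvature potential $\vec x$ with $\vec 1^\top\vec x\ne 0$, then $X(G)\cap\mathbb{R}\vec 1$ is a single point, and the curvature index $\iota(G)\in\mathbb{R}$ is defined by $X(G)\cap\mathbb{R}\vec 1=\{\iota(G)\vec 1\}$; otherwise (i.e. $G$ is not distance exceptional and all curvature potentials have coordinate sum zero) $\iota(G):=\infty$.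
   Formalization: Curvature potentials, the vectors defining X(G) and the finite values of the curvature index are taken over ℚ instead of ℝ. -}

module Defs where

open import Data.Nat using (ℕ; zero; suc)
open import Data.Fin using (Fin; zero; suc)
open import Data.Fin.Properties using (_≟_)
open import Data.Bool using (Bool; true; false; _∧_; _∨_; if_then_else_)
open import Data.Integer using (+_)
open import Data.Rational using (ℚ; 0ℚ; 1ℚ; _+_; _*_; _/_)
open import Data.Product using (Σ; ∃; _×_)
open import Data.Sum using (_⊎_)
open import Relation.Nullary using (¬_; does)
open import Relation.Binary.PropositionalEquality using (_≡_; _≢_)

record Graph (n : ℕ) : Set where
  field
    adj   : Fin n → Fin n → Bool
    sym   : ∀ u v → adj u v ≡ adj v u
    irrfl : ∀ u → adj u u ≡ false
open Graph public

anyFin : ∀ {n} → (Fin n → Bool) → Bool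
anyFin {zero}  p = false
anyFin {suc n} p = p zero ∨ anyFin (λ i → p (suc i))

reach : ∀ {n} → Graph n → ℕ → Fin n → Fin n → Bool
reach G zero    u v = does (u ≟ v)
reach G (suc k) u v = anyFin (λ w → adj G u w ∧ reach G k w v)

Connected : ∀ {n} → Graph n → Set
Connected G = ∀ u v → ∃ λ k → reach G k u v ≡ true

-- least k in [start, start + fuel) with a walk of length k from u to v
-- (returns start + fuel if there is none).
minReach : ∀ {n} → Graph n → ℕ → ℕ → Fin n → Fin n → ℕ
minReach G zero     k u v = k
minReach G (suc f) k u v = if reach G k u v then k else minReach G f (suc k) u v

-- Shortest-path distance. In a connected graph on n vertices the shortest
-- walk between u and v has length ≤ n - 1, so searching k = 0,…,n-1 suffices.
dist : ∀ {n} → Graph n → Fin n → Fin n → ℕ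
dist {n} G u v = minReach G n 0 u v

Vecℚ : ℕ → Set
Vecℚ n = Fin n → ℚ

sumℚ : ∀ {n} → Vecℚ n → ℚ
sumℚ {zero}  x = 0ℚ
sumℚ {suc n} x = x zero + sumℚ (λ i → x (suc i))

Dmul : ∀ {n} → Graph n → Vecℚ n → Vecℚ n
Dmul G x i = sumℚ (λ j → (+ dist G i j / 1) * x j)

CurvaturePotential : ∀ {n} → Graph n → Vecℚ n → Set
CurvaturePotential G x = ∀ i → Dmul G x i ≡ 1ℚ

DistanceExceptional : ∀ {n} → Graph n → Set
DistanceExceptional {n} G = ¬ (Σ (Vecℚ n) (CurvaturePotential G))

-- t·1 ∈ X(G) = { D x : 1ᵀx = 1 }
InXline : ∀ {n} → Graph n → ℚ → Set
InXline {n} G t = Σ (Vecℚ n) λ x → (sumℚ x ≡ 1ℚ) × (∀ i → Dmul G x i ≡ t)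

-- Extended values ℝ ∪ {∞} (here ℚ ∪ {∞}) for the curvature index.
data Ext : Set where
  fin : ℚ → Ext
  ∞   : Ext

FiniteCase : ∀ {n} → Graph n → Set
FiniteCase {n} G =
  DistanceExceptional G ⊎ Σ (Vecℚ n) (λ x → CurvaturePotential G x × sumℚ x ≢ 0ℚ)

-- CurvatureIndexIs G e  :⇔  ι(G) = e, unfolding the definition of ι.
CurvatureIndexIs : ∀ {n} → Graph n → Ext → Set
CurvatureIndexIs G (fin c) = FiniteCase G × (∀ t → (InXline G t → t ≡ c) × (t ≡ c → InXline G t))
CurvatureIndexIs G ∞       = ¬ FiniteCase G

{-# OPTIONS --safe #-}
module Submission where

-- If G is not distance exceptional but ι(G) is finite, some curvature potential x has 1ᵀx ≠ 0;
-- then x / 1ᵀx has coordinate sum 1 and D (x / 1ᵀx) = (1 / 1ᵀx)·1, so ι(G) = 1 / 1ᵀx ≠ 0.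
-- Conversely, let G be distance exceptional. Rescaling a preimage of t·1 with t ≠ 0 would give
-- a potential, so only t = 0 can occur. And it does: as D x = 1 is unsolvable, the Fredholm
-- alternative gives y with yᵀD = 0 and yᵀ1 ≠ 0; D is symmetric, so D (y / 1ᵀy) = 0.

open import Defs hiding (sym)
open import Data.Bool using (Bool; true; false; _∧_; _∨_; if_then_else_)
open import Data.Bool.Properties using (∨-zeroʳ; ∧-conicalˡ; ∧-conicalʳ; ⇔→≡)
open import Data.Fin using (Fin; zero; suc)
open import Data.Fin.Properties using (all?; ¬∀⟶∃¬) renaming (_≟_ to _≟ᶠ_)
import Data.Integer as ℤ
open import Data.Nat using (ℕ; zero; suc)
open import Data.Product using (_×_; _,_; ∃; proj₁)
open import Data.Rational using (ℚ; 0ℚ; 1ℚ; _+_; _-_; _*_; _÷_; _/_; 1/_; NonZero; ≢-nonZero)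
open import Data.Rational.Properties
  using (_≟_; *-assoc; *-comm; *-identityʳ; *-zeroˡ; *-distribʳ-+; *-inverseˡ; *-inverseʳ; +-inverseʳ)
open import Data.Sum as Sum using (_⊎_; inj₁; inj₂)
open import Data.Empty using (⊥-elim)
open import Data.Vec.Functional using ([]; _∷_)
open import Function using (_∘_; mk⇔)
open import Relation.Binary.PropositionalEquality using (_≡_; _≢_; refl; sym; trans; cong; cong₂; subst; module ≡-Reasoning)
open import Relation.Nullary using (yes; no)
open import Relation.Nullary.Decidable using (dec-true; decidable-stable)
open import Data.Rational.Solver using (module +-*-Solver)
open +-*-Solver using (solve; _:+_; _:-_; _:*_; _:=_; con)

anyFin-true : ∀ {n} (p : Fin n → Bool) w → p w ≡ true → anyFin p ≡ true
anyFin-true p zero    pw = cong (_∨ anyFin (p ∘ suc)) pw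
anyFin-true p (suc w) pw = trans (cong (p zero ∨_) (anyFin-true (p ∘ suc) w pw)) (∨-zeroʳ (p zero))

anyFin-true⁻ : ∀ {n} (p : Fin n → Bool) → anyFin p ≡ true → ∃ λ w → p w ≡ true
anyFin-true⁻ {suc n} p h with p zero in p₀
... | true  = zero , p₀
... | false with anyFin-true⁻ (p ∘ suc) h
...   | w , pw = suc w , pw

module _ {n} (G : Graph n) where

  reach-zero⁻ : ∀ {u v} → reach G 0 u v ≡ true → u ≡ v
  reach-zero⁻ {u} {v} h with u ≟ᶠ v
  reach-zero⁻ _  | yes u≡v = u≡v
  reach-zero⁻ () | no _

  reach-snoc : ∀ k {u w v} → reach G k u w ≡ true → adj G w v ≡ true → reach G (suc k) u v ≡ true
  reach-snoc zero {u} {w} {v} h wv with reach-zero⁻ {u} {w} h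
  ... | refl = anyFin-true _ v (cong₂ _∧_ wv (dec-true (v ≟ᶠ v) refl))
  reach-snoc (suc k) {u} h wv with anyFin-true⁻ _ h
  ... | u′ , hu′ = anyFin-true _ u′
          (cong₂ _∧_ (∧-conicalˡ _ _ hu′) (reach-snoc k (∧-conicalʳ (adj G u u′) _ hu′) wv))

  reach-sym : ∀ k {u v} → reach G k u v ≡ true → reach G k v u ≡ true
  reach-sym zero {u} {v} h with reach-zero⁻ {u} {v} h
  ... | refl = h
  reach-sym (suc k) {u} h with anyFin-true⁻ _ h
  ... | w , hw = reach-snoc k (reach-sym k (∧-conicalʳ (adj G u w) _ hw))
                   (trans (Graph.sym G w u) (∧-conicalˡ _ _ hw))

  reach-comm : ∀ k u v → reach G k u v ≡ reach G k v u
  reach-comm k u v = ⇔→≡ (mk⇔ (reach-sym k) (reach-sym k))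

  minReach-comm : ∀ fuel k u v → minReach G fuel k u v ≡ minReach G fuel k v u
  minReach-comm zero       k u v = refl
  minReach-comm (suc fuel) k u v =
    cong₂ (λ b m → if b then k else m) (reach-comm k u v) (minReach-comm fuel (suc k) u v)

  dist-sym : ∀ u v → dist G u v ≡ dist G v u
  dist-sym = minReach-comm n 0

Matrix : ℕ → ℕ → Set
Matrix n m = Fin n → Fin m → ℚ

column : ∀ {n m} → Matrix n m → Fin m → Vecℚ n
column A j i = A i j

dropFirstColumn : ∀ {n m} → Matrix n (suc m) → Matrix n m
dropFirstColumn A i j = A i (suc j)

infixr 7 _*ᵥ_
infix  8 _∙_
infixl 6 _-[_]_

_*ᵥ_ : ∀ {n m} → Matrix n m → Vecℚ m → Vecℚ n
(A *ᵥ x) i = sumℚ (λ j → A i j * x j)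

_∙_ : ∀ {n} → Vecℚ n → Vecℚ n → ℚ
u ∙ v = sumℚ (λ i → u i * v i)

_-[_]_ : ∀ {n} → Vecℚ n → ℚ → Vecℚ n → Vecℚ n
(u -[ c ] v) i = u i - c * v i

unit : ∀ {n} → Fin n → Vecℚ n
unit zero    = 1ℚ ∷ λ _ → 0ℚ
unit (suc k) = 0ℚ ∷ unit k

sumℚ-cong : ∀ {n} {f g : Vecℚ n} → (∀ i → f i ≡ g i) → sumℚ f ≡ sumℚ g
sumℚ-cong {zero}  f≗g = refl
sumℚ-cong {suc n} f≗g = cong₂ _+_ (f≗g zero) (sumℚ-cong (f≗g ∘ suc))

sumℚ-*ʳ : ∀ {n} (x : Vecℚ n) c → sumℚ (λ j → x j * c) ≡ sumℚ x * c
sumℚ-*ʳ {zero}  x c = sym (*-zeroˡ c)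
sumℚ-*ʳ {suc n} x c = trans (cong (x zero * c +_) (sumℚ-*ʳ (x ∘ suc) c)) (sym (*-distribʳ-+ c (x zero) _))

sumℚ-linear : ∀ {n} (f : Vecℚ n) c g → sumℚ (f -[ c ] g) ≡ sumℚ f - c * sumℚ g
sumℚ-linear {zero}  f c g = solve 1 (λ c → con 0ℚ := con 0ℚ :- c :* con 0ℚ) refl c
sumℚ-linear {suc n} f c g =
  trans (cong (f zero - c * g zero +_) (sumℚ-linear (f ∘ suc) c (g ∘ suc)))
        (solve 5 (λ p c q P Q → (p :- c :* q) :+ (P :- c :* Q) := (p :+ P) :- c :* (q :+ Q))
               refl (f zero) c (g zero) (sumℚ (f ∘ suc)) (sumℚ (g ∘ suc)))

*ᵥ-*ʳ : ∀ {n m} (A : Matrix n m) x c i → (A *ᵥ (λ j → x j * c)) i ≡ (A *ᵥ x) i * c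
*ᵥ-*ʳ A x c i = trans (sumℚ-cong λ j → sym (*-assoc (A i j) (x j) c)) (sumℚ-*ʳ (λ j → A i j * x j) c)

∙-comm : ∀ {n} (u v : Vecℚ n) → u ∙ v ≡ v ∙ u
∙-comm u v = sumℚ-cong λ i → *-comm (u i) (v i)

∙-linearʳ : ∀ {n} (u v : Vecℚ n) c w → u ∙ (v -[ c ] w) ≡ u ∙ v - c * (u ∙ w)
∙-linearʳ u v c w =
  trans (sumℚ-cong λ i → solve 4 (λ p q c r → p :* (q :- c :* r) := p :* q :- c :* (p :* r))
                                 refl (u i) (v i) c (w i))
        (sumℚ-linear (λ i → u i * v i) c (λ i → u i * w i))

∙-linearˡ : ∀ {n} (u : Vecℚ n) c v w → (u -[ c ] v) ∙ w ≡ u ∙ w - c * (v ∙ w)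
∙-linearˡ u c v w = begin
  (u -[ c ] v) ∙ w      ≡⟨ ∙-comm (u -[ c ] v) w ⟩
  w ∙ (u -[ c ] v)      ≡⟨ ∙-linearʳ w u c v ⟩
  w ∙ u - c * (w ∙ v)   ≡⟨ cong₂ (λ p q → p - c * q) (∙-comm w u) (∙-comm w v) ⟩
  u ∙ w - c * (v ∙ w)   ∎
  where open ≡-Reasoning

∙-unit : ∀ {n} (b : Vecℚ n) (k : Fin n) → b ∙ unit k ≡ b k
∙-unit b zero    = trans (cong (b zero * 1ℚ +_) (sumℚ-*ʳ (b ∘ suc) 0ℚ))
                         (solve 2 (λ p q → p :* con 1ℚ :+ q :* con 0ℚ := p) refl (b zero) (sumℚ (b ∘ suc)))
∙-unit b (suc k) = trans (cong (b zero * 0ℚ +_) (∙-unit (b ∘ suc) k))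
                         (solve 2 (λ p q → p :* con 0ℚ :+ q := q) refl (b zero) (b (suc k)))

Solvable : ∀ {n m} → Matrix n m → Vecℚ n → Set
Solvable A b = ∃ λ x → ∀ i → (A *ᵥ x) i ≡ b i

Obstructed : ∀ {n m} → Matrix n m → Vecℚ n → Set
Obstructed A b = ∃ λ y → (∀ j → y ∙ column A j ≡ 0ℚ) × y ∙ b ≢ 0ℚ

p÷q*q≡p : ∀ p q .{{_ : NonZero q}} → p ÷ q * q ≡ p
p÷q*q≡p p q = trans (*-assoc p (1/ q) q) (trans (cong (p *_) (*-inverseˡ q)) (*-identityʳ p))

fredholm-without-columns : ∀ {n} (A : Matrix n 0) b → Solvable A b ⊎ Obstructed A b
fredholm-without-columns A b with all? (λ i → b i ≟ 0ℚ)
... | yes b≡0 = inj₁ ([] , λ i → sym (b≡0 i))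
... | no b≢0 with ¬∀⟶∃¬ _ _ (λ i → b i ≟ 0ℚ) b≢0
...   | k , bₖ≢0 = inj₂ (unit k , (λ ()) , λ eₖ∙b≡0 →
          bₖ≢0 (trans (sym (∙-unit b k)) (trans (∙-comm b (unit k)) eₖ∙b≡0)))

-- One step of Gaussian elimination, with y as the pivot for the first column a.
module Pivot {n m} (A : Matrix n (suc m)) (b y : Vecℚ n)
  (y⊥A′ : ∀ j → y ∙ column A (suc j) ≡ 0ℚ) (y∙a≢0 : y ∙ column A zero ≢ 0ℚ) where

  a : Vecℚ n
  a = column A zero

  instance
    y∙a-nonZero : NonZero (y ∙ a)
    y∙a-nonZero = ≢-nonZero y∙a≢0

  t : ℚ
  t = (y ∙ b) ÷ (y ∙ a)

  b′ : Vecℚ n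
  b′ = b -[ t ] a

  lift-solution : Solvable (dropFirstColumn A) b′ → Solvable A b
  lift-solution (x , A′x≡b′) = t ∷ x , λ i →
    trans (cong (A i zero * t +_) (A′x≡b′ i))
          (solve 3 (λ p t q → p :* t :+ (q :- t :* p) := q) refl (A i zero) t (b i))

  lift-obstruction : Obstructed (dropFirstColumn A) b′ → Obstructed A b
  lift-obstruction (z , z⊥A′ , z∙b′≢0) = w , w⊥A , w∙b≢0
    where
    open ≡-Reasoning
    s : ℚ
    s = (z ∙ a) ÷ (y ∙ a)

    w : Vecℚ n
    w = z -[ s ] y

    w⊥A : ∀ j → w ∙ column A j ≡ 0ℚ
    w⊥A zero = begin
      w ∙ a                  ≡⟨ ∙-linearˡ z s y a ⟩
      z ∙ a - s * (y ∙ a)    ≡⟨ cong (_-_ (z ∙ a)) (p÷q*q≡p (z ∙ a) (y ∙ a)) ⟩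
      z ∙ a - z ∙ a          ≡⟨ +-inverseʳ (z ∙ a) ⟩
      0ℚ                     ∎
    w⊥A (suc j) = begin
      w ∙ column A (suc j)                              ≡⟨ ∙-linearˡ z s y _ ⟩
      z ∙ column A (suc j) - s * (y ∙ column A (suc j)) ≡⟨ cong₂ (λ p q → p - s * q) (z⊥A′ j) (y⊥A′ j) ⟩
      0ℚ - s * 0ℚ                                       ≡⟨ solve 1 (λ s → con 0ℚ :- s :* con 0ℚ := con 0ℚ) refl s ⟩
      0ℚ                                                ∎

    w∙b≢0 : w ∙ b ≢ 0ℚ
    w∙b≢0 w∙b≡0 = z∙b′≢0 (begin
      z ∙ b′                        ≡⟨ ∙-linearʳ z b t a ⟩
      z ∙ b - t * (z ∙ a)           ≡⟨ solve 4 (λ p q r u → p :- (q :* r) :* u := p :- (u :* r) :* q)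
                                              refl (z ∙ b) (y ∙ b) (1/ (y ∙ a)) (z ∙ a) ⟩
      z ∙ b - s * (y ∙ b)           ≡⟨ sym (∙-linearˡ z s y b) ⟩
      w ∙ b                         ≡⟨ w∙b≡0 ⟩
      0ℚ                            ∎)

fredholm-alternative : ∀ {n m} (A : Matrix n m) b → Solvable A b ⊎ Obstructed A b
fredholm-alternative {m = zero} A b = fredholm-without-columns A b
fredholm-alternative {m = suc m} A b with fredholm-alternative (dropFirstColumn A) b
... | inj₁ (x , A′x≡b) = inj₁ (0ℚ ∷ x , λ i →
        trans (solve 2 (λ p q → p :* con 0ℚ :+ q := q) refl (A i zero) _) (A′x≡b i))
... | inj₂ (y , y⊥A′ , y∙b≢0) with y ∙ column A zero ≟ 0ℚ
...   | yes y⊥a = inj₂ (y , (λ { zero → y⊥a ; (suc j) → y⊥A′ j }) , y∙b≢0)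
...   | no y∙a≢0 = Sum.map lift-solution lift-obstruction (fredholm-alternative (dropFirstColumn A) b′)
  where open Pivot A b y y⊥A′ y∙a≢0

÷-≢0 : ∀ {p} q .{{_ : NonZero q}} → p ≢ 0ℚ → p ÷ q ≢ 0ℚ
÷-≢0 {p} q p≢0 p÷q≡0 = p≢0 (begin
  p          ≡⟨ sym (p÷q*q≡p p q) ⟩
  p ÷ q * q  ≡⟨ cong (_* q) p÷q≡0 ⟩
  0ℚ * q     ≡⟨ *-zeroˡ q ⟩
  0ℚ         ∎)
  where open ≡-Reasoning

module _ {n} (G : Graph n) where

  distanceMatrix : Matrix n n
  distanceMatrix i j = ℤ.+ dist G i j / 1

  ∙-column-distanceMatrix : ∀ y j → y ∙ column distanceMatrix j ≡ Dmul G y j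
  ∙-column-distanceMatrix y j = sumℚ-cong λ i →
    trans (*-comm (y i) _) (cong (λ d → (ℤ.+ d / 1) * y i) (dist-sym G i j))

  rescale : ∀ {x t} c → (∀ i → Dmul G x i ≡ t) → ∀ i → Dmul G (λ j → x j * c) i ≡ t * c
  rescale {x} c Dx≡t i = trans (*ᵥ-*ʳ distanceMatrix x c i) (cong (_* c) (Dx≡t i))

  normalise : ∀ {x t} .{{_ : NonZero (sumℚ x)}} → (∀ i → Dmul G x i ≡ t) → InXline G (t ÷ sumℚ x)
  normalise {x} Dx≡t = (λ j → x j ÷ sumℚ x) , trans (sumℚ-*ʳ x _) (*-inverseʳ (sumℚ x)) , rescale _ Dx≡t

  exceptional⇒line⊆0 : DistanceExceptional G → ∀ {t} → InXline G t → t ≡ 0ℚ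
  exceptional⇒line⊆0 ex {t} (x , _ , Dx≡t) = decidable-stable (t ≟ 0ℚ) λ t≢0 →
    let instance _ = ≢-nonZero t≢0
    in ex ((λ j → x j ÷ t) , λ i → trans (rescale _ Dx≡t i) (*-inverseʳ t))

  exceptional⇒0∈line : DistanceExceptional G → InXline G 0ℚ
  exceptional⇒0∈line ex with fredholm-alternative distanceMatrix (λ _ → 1ℚ)
  ... | inj₁ potential = ⊥-elim (ex potential)
  ... | inj₂ (y , y⊥D , y∙1≢0) = subst (InXline G) (*-zeroˡ (1/ sumℚ y)) (normalise Dy≡0)
    where
    Dy≡0 : ∀ i → Dmul G y i ≡ 0ℚ
    Dy≡0 i = trans (sym (∙-column-distanceMatrix y i)) (y⊥D i)
    instance
      Σy-nonZero : NonZero (sumℚ y)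
      Σy-nonZero = ≢-nonZero (y∙1≢0 ∘ trans (sumℚ-cong λ i → *-identityʳ (y i)))

  exceptional⇒index-zero : DistanceExceptional G → CurvatureIndexIs G (fin 0ℚ)
  exceptional⇒index-zero ex = inj₁ ex , λ t → exceptional⇒line⊆0 ex , λ { refl → exceptional⇒0∈line ex }

  index-zero⇒exceptional : CurvatureIndexIs G (fin 0ℚ) → DistanceExceptional G
  index-zero⇒exceptional (inj₁ ex , _) = ex
  index-zero⇒exceptional (inj₂ (x , Dx≡1 , Σx≢0) , ι≡0) _ =
    ÷-≢0 {1ℚ} (sumℚ x) (λ ()) (proj₁ (ι≡0 _) (normalise Dx≡1))
    where instance _ = ≢-nonZero Σx≢0

lemma3p2 : ∀ {n} (G : Graph n) → Connected G →
    (DistanceExceptional G → CurvatureIndexIs G (fin 0ℚ)) ×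
    (CurvatureIndexIs G (fin 0ℚ) → DistanceExceptional G)
lemma3p2 G _ = exceptional⇒index-zero G , index-zero⇒exceptional G
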